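{- Let $k$ be a positive integer and $\mathcal{G}$ a $k$-degenerate ordered graph with $n$ vertices. Then for every $N\ge n^2$, every coloring of the edges of $\mathcal{K}_N$ with red and blue contains either a blue copy of $\mathcal{G}$ or a red copy of $\mathcal{K}_{t,t}$, where $t=(N/n^2)^{1/(k+1)}$.
   Context: An ordered graph is a finite simple graph with a total ordering of its vertices; a copy of an ordered graph in another is given by an edge-preserving injection that preserves orderings. A graph is $k$-degenerate if every subgraph has a vertex of degree at most $k$. $\mathcal{K}_N$ is the complete graph on $N$ totally ordered vertices. $\mathcal{K}_{t,t}$ denotes the ordered complete bipartite graph with color classes of size $t$ forming two consecutive intervals, i.e. its $2t$ vertices are ordered so that each of the first $t$ vertices is adjacent to each of the last $t$ vertices, with no other edges. The paper omits floor signs; $t$ is to be understood as rounded down to an integer. -}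

module Defs where

open import Data.Nat using (ℕ; zero; suc; _+_; _*_; _^_; _≤_; _<_)
open import Data.Fin using (Fin; toℕ)
open import Data.Fin.Subset using (Subset; _∈_; Nonempty; ∣_∣)
open import Data.Bool using (Bool; true; false)
open import Data.Vec using (tabulate; lookup)
open import Data.Product using (Σ; ∃; _×_; _,_)
open import Relation.Binary.PropositionalEquality using (_≡_)

record OrdGraph (n : ℕ) : Set where
  field
    adj   : Fin n → Fin n → Bool
    sym   : ∀ i j → adj i j ≡ adj j i
    irrefl : ∀ i → adj i i ≡ false
open OrdGraph public

record Subgraph {n : ℕ} (G : OrdGraph n) : Set where
  field
    verts : Subset n
    edges : Fin n → Fin n → Bool
    edges-sym : ∀ i j → edges i j ≡ edges j i
    edges-⊆ : ∀ i j → edges i j ≡ true → (adj G i j ≡ true) × (i ∈ verts) × (j ∈ verts)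
open Subgraph public

degree : {n : ℕ} {G : OrdGraph n} → Subgraph G → Fin n → ℕ
degree H v = ∣ tabulate (λ u → edges H v u) ∣

Degenerate : ℕ → {n : ℕ} → OrdGraph n → Set
Degenerate k G = ∀ (H : Subgraph G) → Nonempty (verts H) →
  ∃ λ v → v ∈ verts H × degree H v ≤ k

StrictMono : {a b : ℕ} → (Fin a → Fin b) → Set
StrictMono {a} f = ∀ (i j : Fin a) → toℕ i < toℕ j → toℕ (f i) < toℕ (f j)

-- A red/blue colouring of the edges of K_N: c i j for toℕ i < toℕ j is the
-- colour of edge {i,j}; true = red, false = blue (values with i ≥ j are ignored).
Colouring : ℕ → Set
Colouring N = Fin N → Fin N → Bool

BlueCopy : {n N : ℕ} → Colouring N → OrdGraph n → Set
BlueCopy {n} {N} c G = Σ (Fin n → Fin N) λ f → StrictMono f ×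
  (∀ i j → toℕ i < toℕ j → adj G i j ≡ true → c (f i) (f j) ≡ false)

-- red copy of ordered K_{t,t}: vertices 0..2t-1, each of the first t
-- adjacent to each of the last t.
RedKtt : {N : ℕ} → Colouring N → ℕ → Set
RedKtt {N} c t = Σ (Fin (t + t) → Fin N) λ f → StrictMono f ×
  (∀ i j → toℕ i < t → t ≤ toℕ j → c (f i) (f j) ≡ true)

-- Cut [N] into n consecutive blocks of size m = t^(k+1)·n, block v reserved for
-- vertex v, so any placement of each vertex inside its own block is order preserving.
-- Embed G greedily, in the reverse of a degeneracy order: to embed a vertex set S, remove a
-- vertex v of degree ≤ k in G[S], embed S - v, then place v.  The invariant (Good) is
-- that adjacent placed vertices are blue and every unplaced w with j placed neighbours
-- keeps L j = t^(k+1-j)·n candidates in its block blue to all of them.  Placing v at x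
-- is bad for an unplaced neighbour w if x is blue to fewer than L (j+1) of w's candidates.
-- If t candidates of v are bad for the same w, counting survivors yields t candidates of w
-- red to all of them: a red K_{t,t}.  Otherwise fewer than t·n of the ≥ t·n candidates of v
-- are bad, so some candidate is bad for nobody and the invariant is restored.

module Submission where

open import Defs renaming (sym to adj-sym)
open import Data.Bool as Bool using (Bool; true; false; _∧_)
open import Data.Bool.Properties using (∧-comm; ¬-not)
open import Data.Empty using (⊥-elim)
open import Data.Nat using (ℕ; zero; suc; _+_; _*_; _∸_; _^_; _≤_; _<_; z≤n; s≤s; s≤s⁻¹; s<s⁻¹; _<?_; _≤?_; NonZero; >-nonZero⁻¹)
open import Data.Nat.Properties
open import Data.Fin as Fin using (Fin; zero; suc; toℕ; inject≤; combine; _↑ˡ_; _↑ʳ_)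
open import Data.Fin.Properties using (all?; any?; toℕ-inject≤; toℕ-↑ˡ; toℕ-↑ʳ; toℕ<n; toℕ-injective; toℕ-combine; combine-monoˡ-<)
open import Data.Fin.Subset using (Subset; Empty; Nonempty; ⊤; _∈_; _∉_; _∩_; _─_; _-_; _⊆_; ∣_∣; ⁅_⁆; inside; outside)
open import Data.Fin.Subset.Properties using (_∈?_; nonempty?; ∣p∣≤n; ∈⊤; x∈p⇒∣p-x∣<∣p∣; x∈p∧x≢y⇒x∈p-y; x∈p∩q⁺; x∈p∩q⁻; x∈⁅x⁆; p─q⊆p; p⊆q⇒∣p∣≤∣q∣; p⊂q⇒∣p∣<∣q∣)
open import Data.List using (List; []; _∷_; length; filter; lookup; take; allFin)
open import Data.List.Properties using (filter-all; length-take; length-tabulate)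
open import Data.List.Membership.Propositional using () renaming (_∈_ to _∈ₗ_)
open import Data.List.Membership.Propositional.Properties using (∈-lookup; ∈-allFin)
open import Data.List.Relation.Unary.All as All using (All; []; _∷_)
open import Data.List.Relation.Unary.All.Properties using (all-filter; tabulate⁺) renaming (take⁺ to All-take⁺; filter⁺ to All-filter⁺)
open import Data.List.Relation.Unary.AllPairs using (AllPairs; []; _∷_)
import Data.List.Relation.Unary.AllPairs.Properties as AllPairs
open import Data.Vec using (_∷_; tabulate; here; there)
open import Data.Vec.Properties using (lookup∘tabulate; lookup⇒[]=; []=⇒lookup)
import Data.Vec as Vec
open import Data.Vec.Functional using (updateAt)
open import Data.Vec.Functional.Properties using (updateAt-updates; updateAt-minimal)
open import Data.Product using (Σ; ∃; _×_; _,_; proj₁; proj₂)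
open import Relation.Nullary.Decidable using (_×-dec_)
open import Data.Sum using (_⊎_; inj₁; inj₂; [_,_]′)
open import Function using (_∘_; id)
open import Level using (0ℓ)
open import Relation.Binary using (tri<; tri≈; tri>)
open import Relation.Binary.PropositionalEquality using (_≡_; _≢_; refl; sym; trans; cong; cong₂; subst; subst₂)
open import Relation.Nullary using (Dec; ¬_; yes; no; ¬?; _→-dec_)
open import Relation.Unary using (Pred; Decidable)

module _ {A : Set} where

  length-filter-mono : {P Q : Pred A 0ℓ} (P? : Decidable P) (Q? : Decidable Q) →
    (∀ {x} → P x → Q x) → ∀ xs → length (filter P? xs) ≤ length (filter Q? xs)
  length-filter-mono P? Q? P⇒Q [] = z≤n
  length-filter-mono P? Q? P⇒Q (x ∷ xs) with ih ← length-filter-mono P? Q? P⇒Q xs | P? x | Q? x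
  ... | yes _  | yes _  = s≤s ih
  ... | yes px | no ¬qx = ⊥-elim (¬qx (P⇒Q px))
  ... | no _   | yes _  = m≤n⇒m≤1+n ih
  ... | no _   | no _   = ih

  length-filter-filter : {P Q R : Pred A 0ℓ} (P? : Decidable P) (Q? : Decidable Q) (R? : Decidable R) →
    (∀ {x} → P x → Q x → R x) → ∀ xs → length (filter P? (filter Q? xs)) ≤ length (filter R? xs)
  length-filter-filter P? Q? R? PQ⇒R [] = z≤n
  length-filter-filter P? Q? R? PQ⇒R (x ∷ xs) with ih ← length-filter-filter P? Q? R? PQ⇒R xs | Q? x | R? x
  ... | no _   | yes _  = m≤n⇒m≤1+n ih
  ... | no _   | no _   = ih
  ... | yes qx | yes _ with P? x
  ...   | yes _  = s≤s ih
  ...   | no _   = m≤n⇒m≤1+n ih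
  length-filter-filter P? Q? R? PQ⇒R (x ∷ xs) | yes qx | no ¬rx with P? x
  ...   | yes px = ⊥-elim (¬rx (PQ⇒R px qx))
  ...   | no _   = ih

  length-filter-split : {P Q R : Pred A 0ℓ} (P? : Decidable P) (Q? : Decidable Q) (R? : Decidable R) →
    (∀ {x} → Q x → ¬ P x → R x) → ∀ xs → length (filter Q? xs) ≤ length (filter R? xs) + length (filter P? xs)
  length-filter-split P? Q? R? Q¬P⇒R [] = z≤n
  length-filter-split P? Q? R? Q¬P⇒R (x ∷ xs) with ih ← length-filter-split P? Q? R? Q¬P⇒R xs | P? x | Q? x | R? x
  ... | yes _  | no _   | yes _  = ≤-trans ih (+-mono-≤ (n≤1+n _) (n≤1+n _))
  ... | yes _  | no _   | no _   = ≤-trans ih (+-monoʳ-≤ _ (n≤1+n _))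
  ... | no _   | no _   | yes _  = m≤n⇒m≤1+n ih
  ... | no _   | no _   | no _   = ih
  ... | yes _  | yes _  | yes _  = s≤s (≤-trans ih (+-monoʳ-≤ _ (n≤1+n _)))
  ... | no _   | yes _  | yes _  = s≤s ih
  ... | yes _  | yes _  | no _   = ≤-trans (s≤s ih) (≤-reflexive (sym (+-suc _ _)))
  ... | no ¬px | yes qx | no ¬rx = ⊥-elim (¬rx (Q¬P⇒R qx ¬px))

  -- Counting survivors.  Each w ∈ ws "kills" the elements x of X with P w x;
  -- the spared elements are those killed by nobody.
  module _ {B : Set} {P : B → Pred A 0ℓ} (P? : ∀ w → Decidable (P w)) where

    Spared : List B → Pred A 0ℓ
    Spared ws x = All (λ w → ¬ P w x) ws

    spared? : ∀ ws → Decidable (Spared ws)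
    spared? ws x = All.all? (λ w → ¬? (P? w x)) ws

    union-bound : ∀ {d} X ws → All (λ w → length (filter (P? w) X) ≤ d) ws →
      length X ≤ length (filter (spared? ws) X) + length ws * d
    union-bound X [] [] = ≤-reflexive (sym all-spared)
      where
      all-spared : length (filter (spared? []) X) + 0 ≡ length X
      all-spared = trans (+-identityʳ _) (cong length (filter-all (spared? []) (All.universal (λ _ → []) X)))
    union-bound {d} X (w ∷ ws) (kills-w ∷ kills-ws) = begin
      length X                                  ≤⟨ union-bound X ws kills-ws ⟩
      length (filter (spared? ws) X) + rest     ≤⟨ +-monoˡ-≤ rest split ⟩
      spared + killed + rest                    ≡⟨ +-assoc spared killed rest ⟩
      spared + (killed + rest)                  ≤⟨ +-monoʳ-≤ spared (+-monoˡ-≤ rest kills-w) ⟩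
      spared + (d + rest)                       ∎
      where
      open ≤-Reasoning
      spared = length (filter (spared? (w ∷ ws)) X)
      killed = length (filter (P? w) X)
      rest   = length ws * d
      split : length (filter (spared? ws) X) ≤ spared + killed
      split = length-filter-split (P? w) (spared? ws) (spared? (w ∷ ws)) (λ sp ¬pw → ¬pw ∷ sp) X

    survivors : ∀ {b} X ws → All (λ w → length (filter (P? w) X) < b) ws → length ws * b ≤ length X →
      length ws ≤ length (filter (spared? ws) X)
    survivors {zero}  X []       []         _    = z≤n
    survivors {suc d} X ws       few        room = +-cancelʳ-≤ (length ws * d) _ _ (begin
      length ws + length ws * d                          ≡⟨ *-suc (length ws) d ⟨
      length ws * suc d                                  ≤⟨ room ⟩
      length X                                           ≤⟨ union-bound X ws (All.map s≤s⁻¹ few) ⟩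
      length (filter (spared? ws) X) + length ws * d     ∎)
      where open ≤-Reasoning

module _ {A : Set} {R : A → A → Set} where

  AllPairs-lookup : ∀ {xs : List A} → AllPairs R xs →
    ∀ {i j : Fin (length xs)} → i Fin.< j → R (lookup xs i) (lookup xs j)
  AllPairs-lookup {x ∷ xs} (Rx ∷ _)   {zero}  {suc j} _   = All.lookup Rx (∈-lookup j)
  AllPairs-lookup {x ∷ xs} (_  ∷ Rxs) {suc i} {suc j} i<j = AllPairs-lookup Rxs (s<s⁻¹ i<j)

select : {A : Set} {t : ℕ} (xs : List A) → t ≤ length xs → Fin t → A
select xs t≤ i = lookup xs (inject≤ i t≤)

select-∈ : {A : Set} {t : ℕ} (xs : List A) (t≤ : t ≤ length xs) (i : Fin t) → select xs t≤ i ∈ₗ xs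
select-∈ xs t≤ i = ∈-lookup (inject≤ i t≤)

select-mono : {A : Set} {R : A → A → Set} {t : ℕ} {xs : List A} → AllPairs R xs → (t≤ : t ≤ length xs) →
  ∀ {i j : Fin t} → i Fin.< j → R (select xs t≤ i) (select xs t≤ j)
select-mono Rxs t≤ {i} {j} i<j =
  AllPairs-lookup Rxs (subst₂ _<_ (sym (toℕ-inject≤ i t≤)) (sym (toℕ-inject≤ j t≤)) i<j)

data Half (s t : ℕ) : Fin (s + t) → Set where
  left  : (i : Fin s) → Half s t (i ↑ˡ t)
  right : (i : Fin t) → Half s t (s ↑ʳ i)

half : ∀ s {t} (j : Fin (s + t)) → Half s t j
half zero    j       = right j
half (suc s) zero    = left zero
half (suc s) (suc j) with half s j
... | left i  = left (suc i)
... | right i = right i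

glue : {A : Set} {s t : ℕ} → (Fin s → A) → (Fin t → A) → Fin (s + t) → A
glue {s = s} a b j with half s j
... | left i  = a i
... | right i = b i

redKtt-glue : {N t : ℕ} (c : Colouring N) (a b : Fin t → Fin N) → StrictMono a → StrictMono b →
  (∀ i j → toℕ (a i) < toℕ (b j)) → (∀ i j → c (a i) (b j) ≡ true) → RedKtt c t
redKtt-glue {t = t} c a b a-mono b-mono a<b red = glue a b , mono , cross-red
  where
  mono : StrictMono (glue a b)
  mono j j′ j<j′ with half t j | half t j′
  ... | left i  | left i′  = a-mono i i′ (subst₂ _<_ (toℕ-↑ˡ i t) (toℕ-↑ˡ i′ t) j<j′)
  ... | left i  | right i′ = a<b i i′
  ... | right i | left i′  = ⊥-elim (<-asym (subst₂ _<_ (toℕ-↑ʳ t i) (toℕ-↑ˡ i′ t) j<j′)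
                                             (<-≤-trans (toℕ<n i′) (m≤m+n t (toℕ i))))
  ... | right i | right i′ = b-mono i i′ (+-cancelˡ-< t _ _ (subst₂ _<_ (toℕ-↑ʳ t i) (toℕ-↑ʳ t i′) j<j′))
  cross-red : ∀ j j′ → toℕ j < t → t ≤ toℕ j′ → c (glue a b j) (glue a b j′) ≡ true
  cross-red j j′ j<t t≤j′ with half t j | half t j′
  ... | left i  | right i′ = red i i′
  ... | left i  | left i′  = ⊥-elim (≤⇒≯ (subst (t ≤_) (toℕ-↑ˡ i′ t) t≤j′) (toℕ<n i′))
  ... | right i | _        = ⊥-elim (≤⇒≯ (m≤m+n t (toℕ i)) (subst (_< t) (toℕ-↑ʳ t i) j<t))

colour : {N : ℕ} → Colouring N → Fin N → Fin N → Bool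
colour c x y with toℕ x <? toℕ y
... | yes _ = c x y
... | no _  = c y x

colour-< : {N : ℕ} (c : Colouring N) {x y : Fin N} → toℕ x < toℕ y → colour c x y ≡ c x y
colour-< c {x} {y} x<y with toℕ x <? toℕ y
... | yes _   = refl
... | no x≮y  = ⊥-elim (x≮y x<y)

colour-sym : {N : ℕ} (c : Colouring N) (x y : Fin N) → colour c x y ≡ colour c y x
colour-sym c x y with toℕ x <? toℕ y | toℕ y <? toℕ x
... | yes x<y | yes y<x = ⊥-elim (<-asym x<y y<x)
... | yes _   | no _    = refl
... | no _    | yes _   = refl
... | no x≮y  | no y≮x  rewrite toℕ-injective (≤-antisym (≮⇒≥ y≮x) (≮⇒≥ x≮y)) = refl

∈-tabulate⁺ : {n : ℕ} {f : Fin n → Bool} {x : Fin n} → f x ≡ true → x ∈ tabulate f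
∈-tabulate⁺ {f = f} {x} fx = lookup⇒[]= x (tabulate f) (trans (lookup∘tabulate f x) fx)

∈-tabulate⁻ : {n : ℕ} {f : Fin n → Bool} {x : Fin n} → x ∈ tabulate f → f x ≡ true
∈-tabulate⁻ {f = f} {x} x∈ = trans (sym (lookup∘tabulate f x)) ([]=⇒lookup x∈)

∧-true⁻ : {a b : Bool} → a ∧ b ≡ true → a ≡ true × b ≡ true
∧-true⁻ {true} {true} _ = refl , refl

x∈p─q⇒x∉q : {n : ℕ} (p q : Subset n) {x : Fin n} → x ∈ p ─ q → x ∉ q
x∈p─q⇒x∉q (inside ∷ p) (outside ∷ q) here       ()
x∈p─q⇒x∉q (_ ∷ p)      (_ ∷ q)       (there x∈) (there x∈q) = x∈p─q⇒x∉q p q x∈ x∈q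

x∉p-x : {n : ℕ} {p : Subset n} {x : Fin n} → x ∉ p - x
x∉p-x {p = p} {x} x∈ = x∈p─q⇒x∉q p ⁅ x ⁆ x∈ (x∈⁅x⁆ x)

∩-monoʳ-⊆ : {n : ℕ} (p : Subset n) {q r : Subset n} → q ⊆ r → p ∩ q ⊆ p ∩ r
∩-monoʳ-⊆ p q⊆r x∈ = let (x∈p , x∈q) = x∈p∩q⁻ p _ x∈ in x∈p∩q⁺ (x∈p , q⊆r x∈q)

module Neighbourhoods {n : ℕ} (G : OrdGraph n) where

  nbr : Fin n → Subset n
  nbr w = tabulate (adj G w)

  nbr-sym : {u w : Fin n} → u ∈ nbr w → w ∈ nbr u
  nbr-sym {u} {w} u∈ = ∈-tabulate⁺ (trans (adj-sym G u w) (∈-tabulate⁻ u∈))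

  nbr-irrefl : (w : Fin n) → w ∉ nbr w
  nbr-irrefl w w∈ with () ← trans (sym (irrefl G w)) (∈-tabulate⁻ w∈)

  deg : Subset n → Fin n → ℕ
  deg S w = ∣ nbr w ∩ S ∣

  deg-mono : {S S′ : Subset n} → S ⊆ S′ → (w : Fin n) → deg S w ≤ deg S′ w
  deg-mono S⊆S′ w = p⊆q⇒∣p∣≤∣q∣ (∩-monoʳ-⊆ (nbr w) S⊆S′)

  deg-remove : {S : Subset n} {v w : Fin n} → v ∈ S → v ∈ nbr w → deg (S - v) w < deg S w
  deg-remove {S} {v} {w} v∈S v∈nbr = p⊂q⇒∣p∣<∣q∣
    ( ∩-monoʳ-⊆ (nbr w) (p─q⊆p S ⁅ v ⁆)
    , v , x∈p∩q⁺ (v∈nbr , v∈S) , λ v∈ → x∉p-x (proj₂ (x∈p∩q⁻ (nbr w) (S - v) v∈)))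

  induced : Subset n → Subgraph G
  induced S = record
    { verts     = S
    ; edges     = λ i j → adj G i j ∧ (Vec.lookup S i ∧ Vec.lookup S j)
    ; edges-sym = λ i j → cong₂ _∧_ (adj-sym G i j) (∧-comm (Vec.lookup S i) (Vec.lookup S j))
    ; edges-⊆   = λ i j e → let (a , s) = ∧-true⁻ e ; (si , sj) = ∧-true⁻ s
                             in a , lookup⇒[]= i S si , lookup⇒[]= j S sj
    }

  deg-induced : {S : Subset n} {v : Fin n} → v ∈ S → deg (S - v) v ≤ degree (induced S) v
  deg-induced {S} {v} v∈S = p⊆q⇒∣p∣≤∣q∣ λ {u} u∈ →
    let (u∈nbr , u∈S-v) = x∈p∩q⁻ (nbr v) (S - v) u∈
    in ∈-tabulate⁺ (cong₂ _∧_ (∈-tabulate⁻ u∈nbr) (cong₂ _∧_ ([]=⇒lookup v∈S) ([]=⇒lookup (p─q⊆p S ⁅ v ⁆ u∈S-v))))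

All-witness : {A : Set} {P : A → Set} {xs : List A} → All P xs → 0 < length xs → ∃ P
All-witness (px ∷ _) _ = _ , px

module Embedding {k n : ℕ} (G : OrdGraph n) (degenerate : Degenerate k G)
                 {N : ℕ} (c : Colouring N) (t : ℕ) .{{_ : NonZero t}}
                 (fits : t ^ suc k * (n * n) ≤ N) where

  open Neighbourhoods G

  -- Block layout: vertex v owns the block of m consecutive positions starting at m·v.
  m : ℕ
  m = t ^ suc k * n

  blocks-fit : n * m ≤ N
  blocks-fit = begin
    n * (t ^ suc k * n)  ≡⟨ *-comm n (t ^ suc k * n) ⟩
    t ^ suc k * n * n    ≡⟨ *-assoc (t ^ suc k) n n ⟩
    t ^ suc k * (n * n)  ≤⟨ fits ⟩
    N                    ∎
    where open ≤-Reasoning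

  pos : Fin n → Fin m → Fin N
  pos v i = inject≤ (combine v i) blocks-fit

  toℕ-pos : (v : Fin n) (i : Fin m) → toℕ (pos v i) ≡ m * toℕ v + toℕ i
  toℕ-pos v i = trans (toℕ-inject≤ (combine v i) blocks-fit) (toℕ-combine v i)

  pos-monoˡ : {v w : Fin n} {i j : Fin m} → toℕ v < toℕ w → toℕ (pos v i) < toℕ (pos w j)
  pos-monoˡ {v} {w} {i} {j} v<w = subst₂ _<_ (sym (toℕ-inject≤ (combine v i) blocks-fit))
    (sym (toℕ-inject≤ (combine w j) blocks-fit)) (combine-monoˡ-< i j v<w)

  pos-monoʳ : (v : Fin n) {i j : Fin m} → toℕ i < toℕ j → toℕ (pos v i) < toℕ (pos v j)
  pos-monoʳ v {i} {j} i<j = subst₂ _<_ (sym (toℕ-pos v i)) (sym (toℕ-pos v j)) (+-monoʳ-< (m * toℕ v) i<j)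

  -- L j: how many candidates are kept for an unplaced vertex with j placed neighbours.
  -- L 0 = m is a whole block, and each placed neighbour costs a factor t.
  L : ℕ → ℕ
  L j = t ^ (suc k ∸ j) * n

  L-antitone : {i j : ℕ} → i ≤ j → L j ≤ L i
  L-antitone i≤j = *-monoˡ-≤ n (^-monoʳ-≤ t (∸-monoʳ-≤ (suc k) i≤j))

  L-split : {j : ℕ} → j ≤ k → L j ≡ t * L (suc j)
  L-split {j} j≤k = begin-equality
    t ^ (suc k ∸ j) * n      ≡⟨ cong (λ e → t ^ e * n) (+-∸-assoc 1 j≤k) ⟩
    t * t ^ (k ∸ j) * n      ≡⟨ *-assoc t (t ^ (k ∸ j)) n ⟩
    t * (t ^ (k ∸ j) * n)    ∎
    where open ≤-Reasoning

  n≤L : (j : ℕ) → n ≤ L j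
  n≤L j = m≤n*m n (t ^ (suc k ∸ j)) {{m^n≢0 t (suc k ∸ j)}}

  tn≤L : {j : ℕ} → j ≤ k → t * n ≤ L j
  tn≤L {j} j≤k = subst (t * n ≤_) (sym (L-split j≤k)) (*-monoʳ-≤ t (n≤L (suc j)))

  Blue : Fin N → Fin N → Set
  Blue x y = colour c x y ≡ false

  BlueTo : Fin n → Fin m → Fin n → Fin m → Set
  BlueTo v x w y = Blue (pos v x) (pos w y)

  blueTo? : (v : Fin n) (x : Fin m) (w : Fin n) → Decidable (BlueTo v x w)
  blueTo? v x w y = colour c (pos v x) (pos w y) Bool.≟ false

  Sorted : List (Fin m) → Set
  Sorted = AllPairs Fin._<_

  redKtt-blocks : {v w : Fin n} → v ≢ w → (a b : Fin t → Fin m) → StrictMono a → StrictMono b →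
    (∀ i j → colour c (pos v (a i)) (pos w (b j)) ≡ true) → RedKtt c t
  redKtt-blocks {v} {w} v≢w a b a↑ b↑ red with <-cmp (toℕ v) (toℕ w)
  ... | tri< v<w _ _ = redKtt-glue c (pos v ∘ a) (pos w ∘ b)
    (λ i j → pos-monoʳ v ∘ a↑ i j) (λ i j → pos-monoʳ w ∘ b↑ i j) (λ i j → pos-monoˡ v<w)
    (λ i j → trans (sym (colour-< c (pos-monoˡ v<w))) (red i j))
  ... | tri≈ _ v≡w _ = ⊥-elim (v≢w (toℕ-injective v≡w))
  ... | tri> _ _ w<v = redKtt-glue c (pos w ∘ b) (pos v ∘ a)
    (λ i j → pos-monoʳ w ∘ b↑ i j) (λ i j → pos-monoʳ v ∘ a↑ i j) (λ i j → pos-monoˡ w<v)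
    (λ i j → trans (sym (colour-< c (pos-monoˡ w<v))) (trans (colour-sym c (pos w (b i)) (pos v (a j))) (red j i)))

  -- If A ⊆ block v and B ⊆ block w are sorted, |A| ≥ t, |B| ≥ t·b and every a ∈ A is blue
  -- to fewer than b elements of B, there is a red K_{t,t}: some t elements of B are red
  -- to all of the first t elements of A, by counting survivors.
  redKtt-between : {v w : Fin n} → v ≢ w → (A B : List (Fin m)) → Sorted A → Sorted B → {b : ℕ} →
    t ≤ length A → t * b ≤ length B → All (λ a → length (filter (blueTo? v a w) B) < b) A → RedKtt c t
  redKtt-between {v} {w} v≢w A B A↑ B↑ {b} t≤A tb≤B few =
    redKtt-blocks v≢w (select A′ t≤A′) (select R t≤R)
      (λ i j → select-mono (AllPairs.take⁺ t A↑) t≤A′) (λ i j → select-mono R↑ t≤R) red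
    where
    A′ : List (Fin m)
    A′ = take t A
    |A′| : length A′ ≡ t
    |A′| = trans (length-take t A) (m≤n⇒m⊓n≡m t≤A)
    t≤A′ : t ≤ length A′
    t≤A′ = ≤-reflexive (sym |A′|)
    red-to? : Decidable (Spared (λ a → blueTo? v a w) A′)
    red-to? = spared? (λ a → blueTo? v a w) A′
    R : List (Fin m)
    R = filter red-to? B
    R↑ : Sorted R
    R↑ = AllPairs.filter⁺ red-to? B↑
    t≤R : t ≤ length R
    t≤R = subst (_≤ length R) |A′|
      (survivors (λ a → blueTo? v a w) B A′ (All-take⁺ t few) (subst (λ l → l * b ≤ length B) (sym |A′|) tb≤B))
    red : ∀ i j → colour c (pos v (select A′ t≤A′ i)) (pos w (select R t≤R j)) ≡ true
    red i j = ¬-not (All.lookup (All.lookup (all-filter red-to? B) (select-∈ R t≤R j)) (select-∈ A′ t≤A′ i))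

  Placement : Set
  Placement = Fin n → Fin m

  at : Placement → Fin n → Fin N
  at g u = pos u (g u)

  Cand : Subset n → Placement → Fin n → Fin m → Set
  Cand S g w i = ∀ u → u ∈ S → u ∈ nbr w → Blue (at g u) (pos w i)

  cand? : (S : Subset n) (g : Placement) (w : Fin n) → Decidable (Cand S g w)
  cand? S g w i = all? λ u → (u ∈? S) →-dec ((u ∈? nbr w) →-dec blueTo? u (g u) w i)

  cands : Subset n → Placement → Fin n → List (Fin m)
  cands S g w = filter (cand? S g w) (allFin m)

  cands-sorted : (S : Subset n) (g : Placement) (w : Fin n) → Sorted (cands S g w)
  cands-sorted S g w = AllPairs.filter⁺ (cand? S g w) (AllPairs.tabulate⁺-< (λ i<j → i<j))

  record Good (S : Subset n) (g : Placement) : Set where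
    field
      blue-edges : ∀ {u u′} → u ∈ S → u′ ∈ S → u′ ∈ nbr u → Blue (at g u) (at g u′)
      room       : ∀ {w} → w ∉ S → L (deg S w) ≤ length (cands S g w)

  -- Degeneracy guarantees that unplaced vertices have at most k placed neighbours.
  Bounded : Subset n → Set
  Bounded S = ∀ {w} → w ∉ S → deg S w ≤ k

  Outcome : Subset n → Set
  Outcome S = RedKtt c t ⊎ Σ Placement (Good S)

  -- Nothing placed: every index of a block is a candidate, and L j ≤ L 0 = m.
  good-empty : (S : Subset n) → Empty S → Σ Placement (Good S)
  good-empty S empty = g₀ , record
    { blue-edges = λ u∈S _ _ → ⊥-elim (empty (_ , u∈S))
    ; room       = λ {w} _ → begin
        L (deg S w)               ≤⟨ L-antitone {j = deg S w} z≤n ⟩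
        m                         ≡⟨ length-tabulate id ⟨
        length (allFin m)         ≡⟨ cong length (filter-all (cand? S g₀ w) all-cand) ⟨
        length (cands S g₀ w)     ∎
    }
    where
    open ≤-Reasoning
    g₀ : Placement
    g₀ u = inject≤ u (m≤n*m n (t ^ suc k) {{m^n≢0 t (suc k)}})
    all-cand : ∀ {w} → All (Cand S g₀ w) (allFin m)
    all-cand = All.universal (λ i u u∈S _ → ⊥-elim (empty (u , u∈S))) (allFin m)

  module Extend {S : Subset n} {v : Fin n} (v∈S : v ∈ S) (bounded : Bounded S)
                (v-low : deg (S - v) v ≤ k) {g′ : Placement} (good′ : Good (S - v) g′) where

    open Good good′ renaming (blue-edges to blue-edges′; room to room′)

    S′ : Subset n
    S′ = S - v

    ∉S⇒∉S′ : ∀ {w} → w ∉ S → w ∉ S′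
    ∉S⇒∉S′ w∉S = w∉S ∘ p─q⊆p S ⁅ v ⁆

    X₀ : List (Fin m)
    X₀ = cands S′ g′ v

    X₀-large : t * n ≤ length X₀
    X₀-large = ≤-trans (tn≤L v-low) (room′ x∉p-x)

    Bad : Fin n → Fin m → Set
    Bad w x = w ∉ S × w ∈ nbr v × length (filter (blueTo? v x w) (cands S′ g′ w)) < L (suc (deg S′ w))

    bad? : (w : Fin n) → Decidable (Bad w)
    bad? w x = ¬? (w ∈? S) ×-dec (w ∈? nbr v) ×-dec (_ <? _)

    many-bad⇒red : (w : Fin n) → t ≤ length (filter (bad? w) X₀) → RedKtt c t
    many-bad⇒red w many =
      redKtt-between v≢w (filter (bad? w) X₀) (cands S′ g′ w)
        (AllPairs.filter⁺ (bad? w) (cands-sorted S′ g′ v)) (cands-sorted S′ g′ w)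
        many tb≤ (All.map (proj₂ ∘ proj₂) (all-filter (bad? w) X₀))
      where
      w-bad : ∃ (Bad w)
      w-bad = All-witness (all-filter (bad? w) X₀) (<-≤-trans (>-nonZero⁻¹ t) many)
      w∉S : w ∉ S
      w∉S = proj₁ (proj₂ w-bad)
      v≢w : v ≢ w
      v≢w refl = w∉S v∈S
      e′≤k : deg S′ w ≤ k
      e′≤k = <⇒≤ (<-≤-trans (deg-remove v∈S (nbr-sym (proj₁ (proj₂ (proj₂ w-bad))))) (bounded w∉S))
      tb≤ : t * L (suc (deg S′ w)) ≤ length (cands S′ g′ w)
      tb≤ = subst (_≤ length (cands S′ g′ w)) (L-split e′≤k) (room′ (∉S⇒∉S′ w∉S))

    module _ (x : Fin m) (x-cand : Cand S′ g′ v x) (x-ok : ∀ w → ¬ Bad w x) where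

      g : Placement
      g = updateAt g′ v (λ _ → x)

      at-v : at g v ≡ pos v x
      at-v = cong (pos v) (updateAt-updates v g′)

      at-other : ∀ {u} → u ≢ v → at g u ≡ at g′ u
      at-other {u} u≢v = cong (pos u) (updateAt-minimal u v g′ u≢v)

      cand-extend : ∀ {w y} → Cand S′ g′ w y → (w ∈ nbr v → BlueTo v x w y) → Cand S g w y
      cand-extend {w} {y} cand′ compat u = cand-at u (u Fin.≟ v)
        where
        cand-at : ∀ u → Dec (u ≡ v) → u ∈ S → u ∈ nbr w → Blue (at g u) (pos w y)
        cand-at u (yes refl) _   u∈nbr = subst (λ z → Blue z (pos w y)) (sym at-v) (compat (nbr-sym u∈nbr))
        cand-at u (no u≢v)   u∈S u∈nbr = subst (λ z → Blue z (pos w y)) (sym (at-other u≢v))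
                                           (cand′ u (x∈p∧x≢y⇒x∈p-y u∈S u≢v) u∈nbr)

      -- Edges at v are blue since x is a candidate for v; the other edges were blue before.
      blue-edges : ∀ {u u′} → u ∈ S → u′ ∈ S → u′ ∈ nbr u → Blue (at g u) (at g u′)
      blue-edges {u} {u′} = blue-at u u′ (u Fin.≟ v) (u′ Fin.≟ v)
        where
        blue-at : ∀ u u′ → Dec (u ≡ v) → Dec (u′ ≡ v) → u ∈ S → u′ ∈ S → u′ ∈ nbr u → Blue (at g u) (at g u′)
        blue-at u u′ (yes refl) (yes refl) _   _    u′∈nbr = ⊥-elim (nbr-irrefl v u′∈nbr)
        blue-at u u′ (yes refl) (no u′≢v)  _   u′∈S u′∈nbr = subst₂ Blue (sym at-v) (sym (at-other u′≢v))
          (trans (colour-sym c (pos v x) (at g′ u′)) (x-cand u′ (x∈p∧x≢y⇒x∈p-y u′∈S u′≢v) u′∈nbr))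
        blue-at u u′ (no u≢v)   (yes refl) u∈S _    u′∈nbr = subst₂ Blue (sym (at-other u≢v)) (sym at-v)
          (x-cand u (x∈p∧x≢y⇒x∈p-y u∈S u≢v) (nbr-sym u′∈nbr))
        blue-at u u′ (no u≢v)   (no u′≢v)  u∈S u′∈S u′∈nbr = subst₂ Blue (sym (at-other u≢v)) (sym (at-other u′≢v))
          (blue-edges′ (x∈p∧x≢y⇒x∈p-y u∈S u≢v) (x∈p∧x≢y⇒x∈p-y u′∈S u′≢v) u′∈nbr)

      -- An unplaced neighbour w of v gains a placed neighbour but, x not being bad for w,
      -- keeps L (deg S w) candidates; any other unplaced w keeps all its candidates.
      room : ∀ {w} → w ∉ S → L (deg S w) ≤ length (cands S g w)
      room {w} w∉S = room-by (w ∈? nbr v)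
        where
        open ≤-Reasoning
        room-by : Dec (w ∈ nbr v) → L (deg S w) ≤ length (cands S g w)
        room-by (yes w∈nbr) = begin
          L (deg S w)                                       ≤⟨ L-antitone (deg-remove v∈S (nbr-sym w∈nbr)) ⟩
          L (suc (deg S′ w))                                ≤⟨ ≮⇒≥ (λ few → x-ok w (w∉S , w∈nbr , few)) ⟩
          length (filter (blueTo? v x w) (cands S′ g′ w))   ≤⟨ length-filter-filter (blueTo? v x w) (cand? S′ g′ w) (cand? S g w)
                                                                (λ blue cand′ → cand-extend cand′ (λ _ → blue)) (allFin m) ⟩
          length (cands S g w)                              ∎
        room-by (no w∉nbr) = begin
          L (deg S w)                ≤⟨ L-antitone (deg-mono (p─q⊆p S ⁅ v ⁆) w) ⟩
          L (deg S′ w)               ≤⟨ room′ (∉S⇒∉S′ w∉S) ⟩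
          length (cands S′ g′ w)     ≤⟨ length-filter-mono (cand? S′ g′ w) (cand? S g w)
                                         (λ cand′ → cand-extend cand′ (⊥-elim ∘ w∉nbr)) (allFin m) ⟩
          length (cands S g w)       ∎

      extended : Σ Placement (Good S)
      extended = g , record { blue-edges = blue-edges ; room = room }

    -- Either some w has t bad candidates (a red K_{t,t}), or, since |X₀| ≥ t·n, by counting
    -- survivors at least n ≥ 1 candidates for v are bad for nobody.
    extend : Outcome S
    extend = choose (any? (λ w → t ≤? length (filter (bad? w) X₀)))
      where
      choose : Dec (∃ λ w → t ≤ length (filter (bad? w) X₀)) → Outcome S
      choose (yes (w , many)) = inj₁ (many-bad⇒red w many)
      choose (no ¬many)       = inj₂ (extended x x-cand (λ w → All.lookup x-ok (∈-allFin w)))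
        where
        ok? : Decidable (Spared bad? (allFin n))
        ok? = spared? bad? (allFin n)
        few-bad : All (λ w → length (filter (bad? w) X₀) < t) (allFin n)
        few-bad = tabulate⁺ (λ w → ≰⇒> (λ many → ¬many (w , many)))
        |allFin| : length (allFin n) ≡ n
        |allFin| = length-tabulate id
        room-X₀ : length (allFin n) * t ≤ length X₀
        room-X₀ = subst (_≤ length X₀) (trans (*-comm t n) (cong (_* t) (sym |allFin|))) X₀-large
        n≤ok : n ≤ length (filter ok? X₀)
        n≤ok = subst (_≤ length (filter ok? X₀)) |allFin| (survivors bad? X₀ (allFin n) few-bad room-X₀)
        all-ok : All (λ x → Spared bad? (allFin n) x × Cand S′ g′ v x) (filter ok? X₀)
        all-ok = All.zip (all-filter ok? X₀ , All-filter⁺ ok? (all-filter (cand? S′ g′ v) (allFin m)))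
        chosen : ∃ (λ x → Spared bad? (allFin n) x × Cand S′ g′ v x)
        chosen = All-witness all-ok (<-≤-trans (≤-<-trans z≤n (toℕ<n v)) n≤ok)
        x : Fin m
        x = proj₁ chosen
        x-ok : Spared bad? (allFin n) x
        x-ok = proj₁ (proj₂ chosen)
        x-cand : Cand S′ g′ v x
        x-cand = proj₂ (proj₂ chosen)

  embed : (fuel : ℕ) (S : Subset n) → ∣ S ∣ ≤ fuel → Bounded S → Outcome S
  embed fuel S size bounded = by-cases fuel (nonempty? S) size
    where
    by-cases : ∀ fuel → Dec (Nonempty S) → ∣ S ∣ ≤ fuel → Outcome S
    by-cases _          (no empty)          _    = inj₂ (good-empty S empty)
    by-cases zero       (yes (u , u∈S))     size = ⊥-elim (≤⇒≯ size (≤-<-trans z≤n (x∈p⇒∣p-x∣<∣p∣ u∈S)))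
    by-cases (suc fuel) (yes nonempty)      size = remove (degenerate (induced S) nonempty)
      where
      remove : ∃ (λ v → v ∈ S × degree (induced S) v ≤ k) → Outcome S
      remove (v , v∈S , low) =
        [ inj₁ , (λ (g′ , good′) → Extend.extend v∈S bounded v-low good′) ]′ (embed fuel (S - v) size′ bounded′)
        where
        v-low : deg (S - v) v ≤ k
        v-low = ≤-trans (deg-induced v∈S) low
        size′ : ∣ S - v ∣ ≤ fuel
        size′ = s≤s⁻¹ (<-≤-trans (x∈p⇒∣p-x∣<∣p∣ v∈S) size)
        bounded-at : ∀ w → Dec (w ≡ v) → w ∉ S - v → deg (S - v) w ≤ k
        bounded-at w (yes refl) _    = v-low
        bounded-at w (no w≢v)   w∉S′ =
          ≤-trans (deg-mono (p─q⊆p S ⁅ v ⁆) w) (bounded (λ w∈S → w∉S′ (x∈p∧x≢y⇒x∈p-y w∈S w≢v)))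
        bounded′ : Bounded (S - v)
        bounded′ {w} = bounded-at w (w Fin.≟ v)

  blue-or-red : BlueCopy c G ⊎ RedKtt c t
  blue-or-red = [ inj₂ , (λ (g , good) → inj₁ (blue-copy g good)) ]′ (embed n ⊤ (∣p∣≤n ⊤) (λ w∉⊤ → ⊥-elim (w∉⊤ ∈⊤)))
    where
    blue-copy : (g : Placement) → Good ⊤ g → BlueCopy c G
    blue-copy g good = at g , (λ i j → pos-monoˡ) , λ i j i<j ij∈G →
      trans (sym (colour-< c (pos-monoˡ i<j))) (Good.blue-edges good ∈⊤ ∈⊤ (∈-tabulate⁺ ij∈G))

-- For t = 0 the empty K_{0,0} is a red copy; otherwise embed G.
lemma5 : (k n : ℕ) → 1 ≤ k → (G : OrdGraph n) → Degenerate k G →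
    (N : ℕ) → n * n ≤ N → (c : Colouring N) →
    (t : ℕ) → t ^ (suc k) * (n * n) ≤ N → N < suc t ^ (suc k) * (n * n) →
    BlueCopy c G ⊎ RedKtt c t
lemma5 k n _ G degenerate N _ c zero       _    _ = inj₂ ((λ ()) , (λ ()) , (λ ()))
lemma5 k n _ G degenerate N _ c t@(suc _) fits _ = Embedding.blue-or-red G degenerate c t fits
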